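{- Let $k\ge1$ and let $\mathcal{H}$ be a finite hypergraph with $\max_{f\in\mathcal{H}}|f|\le k$. Then for all $p\in[0,1]$ and $r>0$, \[ X_r\le X\le X_r+\mathbf{1}\{\Delta_1(\mathcal{H}_p)>r\}\,k\lceil r\rceil\, M_r(\mathcal{H}_p)\,\Delta_1(\mathcal{H}_p), \] where $X=e(\mathcal{H}_p)$ and $X_r=\max\{e(\mathcal{G}):\ \mathcal{G}\subseteq\mathcal{H}_p,\ \Delta_1(\mathcal{G})\le r\}$.
   Context: $V_p(\mathcal{H})$ is the random subset of $V(\mathcal{H})$ containing each vertex independently with probability $p$, and $\mathcal{H}_p=\mathcal{H}[V_p(\mathcal{H})]$. $\Delta_1(\mathcal{G})$ is the maximum vertex degree. For a hypergraph $\mathcal{G}$ and vertex $v$, $\Gamma_v(\mathcal{G})=\{f\in\mathcal{G}: v\in f\}$. An $r$-star in $\mathcal{G}$ is a pair $S=(v,W)$ with $W=\{f_1,\ldots,f_{\lceil r\rceil}\}\subseteq\Gamma_v(\mathcal{G})$ and $|W|=\lceil r\rceil$; its vertex set is $V(S)=\bigcup_{i}f_i$. $M_r(\mathcal{G})$ is the maximum size of a collection of $r$-stars in $\mathcal{G}$ whose vertex sets $V(S)$ are pairwise disjoint.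
   Formalization: The parameter r ranges over the positive rationals. -}

module Defs where

open import Data.Nat using (ℕ; _⊔_; _≤_)
open import Data.Fin using (Fin)
open import Data.Fin.Subset using (Subset; _∈_; _⊆_; ∣_∣)
open import Data.Fin.Subset.Properties using (_∈?_)
open import Data.List using (List; length; filter; map; foldr; allFin)
open import Data.Product using (Σ; _×_; ∃-syntax)
open import Relation.Nullary using (¬_)
open import Relation.Nullary.Decidable using (_×-dec_)
open import Data.Integer using (+_)
import Data.Integer as ℤ
open import Data.Rational using (ℚ; ceiling; _/_)
import Data.Rational as ℚ
open import Relation.Binary.PropositionalEquality using (_≡_; _≢_)

-- A finite hypergraph on the vertex set Fin n with m edges is given by
-- an injective family  edge : Fin m → Subset n  (distinct edges).
-- A sub-hypergraph (subset of the edge set) is a  Subset m  of edge indices.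

module _ {n m : ℕ} (edge : Fin m → Subset n) where

  InInduced : Subset n → Subset m → Set
  InInduced U G = ∀ i → i ∈ G → edge i ⊆ U

  IsInduced : Subset n → Subset m → Set
  IsInduced U G = InInduced U G × (∀ i → edge i ⊆ U → i ∈ G)

  e : Subset m → ℕ
  e G = ∣ G ∣

  deg : Subset m → Fin n → ℕ
  deg G v = length (filter (λ i → (i ∈? G) ×-dec (v ∈? edge i)) (allFin m))

  Δ₁ : Subset m → ℕ
  Δ₁ G = foldr _⊔_ 0 (map (deg G) (allFin n))

  -- an r-star in G with ⌈r⌉ = c : centre v, c edges of G containing v
  record Star (G : Subset m) (c : ℕ) : Set where
    field
      centre : Fin n
      W      : Subset m
      W⊆G    : W ⊆ G
      W⊆Γv   : ∀ i → i ∈ W → centre ∈ edge i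
      size   : ∣ W ∣ ≡ c

  InV : {G : Subset m} {c : ℕ} → Star G c → Fin n → Set
  InV S w = ∃[ i ] (i ∈ Star.W S × w ∈ edge i)

  DisjointStars : (G : Subset m) (c t : ℕ) → Set
  DisjointStars G c t =
    Σ (Fin t → Star G c) λ S →
      ∀ a b → a ≢ b → ∀ w → ¬ (InV (S a) w × InV (S b) w)

  IsM : (G : Subset m) (c M : ℕ) → Set
  IsM G c M = DisjointStars G c M × (∀ t → DisjointStars G c t → t ≤ M)

ℕtoℚ : ℕ → ℚ
ℕtoℚ d = (+ d) / 1

-- ⌈ r ⌉ as a natural number (used for r > 0)
⌈_⌉ℕ : ℚ → ℕ
⌈ r ⌉ℕ = ℤ.∣ ceiling r ∣

module _ {n m : ℕ} (edge : Fin m → Subset n) where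

  IsXr : Subset n → ℚ → ℕ → Set
  IsXr U r x =
    (∃[ G ] (InInduced edge U G × ℚ._≤_ (ℕtoℚ (Δ₁ edge G)) r × e edge G ≡ x))
    × (∀ G → InInduced edge U G → ℚ._≤_ (ℕtoℚ (Δ₁ edge G)) r → e edge G ≤ x)

𝟙> : ℕ → ℚ → ℕ
𝟙> d r with r ℚ.<? ℕtoℚ d
... | Relation.Nullary.yes _ = 1
... | Relation.Nullary.no _ = 0

-- Fix a maximum family of pairwise vertex-disjoint ⌈r⌉-stars S₁,…,S_M in
-- H_p and delete every edge meeting one of their vertex sets. Each star
-- has ⌈r⌉ edges of at most k vertices, each lying in at most Δ₁(H_p) edges,
-- so at most k⌈r⌉MΔ₁(H_p) edges are deleted. In what is left every vertex
-- has degree below ⌈r⌉, for otherwise ⌈r⌉ of its edges would form a star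
-- disjoint from all the Sₐ; as d < ⌈r⌉ forces d ≤ r, the rest is a
-- candidate for X_r. When Δ₁(H_p) ≤ r, H_p itself is a candidate. The
-- lower bound X_r ≤ X holds because every candidate lies inside H_p.
module Submission where

open import Defs
open import Data.Nat using (ℕ; _≤_; _+_; _*_)
open import Data.Fin using (Fin)
open import Data.Fin.Subset using (Subset; ∣_∣)
open import Data.Product using (_×_)
open import Data.Rational using (ℚ; Positive)
open import Function.Definitions using (Injective)
open import Relation.Binary.PropositionalEquality using (_≡_)

open import Data.Nat as ℕ using (zero; suc; _<_; s≤s; z≤n; _⊔_)
import Data.Nat.Properties as ℕ
import Data.Nat.DivMod as ℕ
import Data.Nat.Coprimality as Coprimality
open import Data.Nat.Tactic.RingSolver using (solve-∀)
open import Data.Bool using (true; false)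
open import Data.Fin using (zero; suc)
open import Data.Fin.Subset using (_∈_; _∉_; _⊆_; _∪_; _─_; ⊥; ⊤; inside; outside)
open import Data.Fin.Subset.Properties
  using (_∈?_; x∈p∪q⁺; ∣⊥∣≡0; ∣⊤∣≡n; ∈⊤; ⊥⊆; p⊆q⇒∣p∣≤∣q∣; p─q⊆p; x∈p∧x∉q⇒x∈p─q)
open import Data.Vec as Vec using ([]; _∷_; here; there)
import Data.Vec.Properties as Vec
open import Data.List as List using (foldr; filter; length; allFin)
import Data.List.Properties as List
open import Data.List.Relation.Unary.All as All using (All)
import Data.List.Relation.Unary.All.Properties as All
import Data.List.Membership.Propositional as List
import Data.List.Membership.Propositional.Properties as List
open import Data.List.Relation.Unary.Any using (here; there)
open import Data.Product using (Σ; _,_; proj₁; proj₂; ∃-syntax)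
open import Data.Sum using (inj₁; inj₂)
open import Relation.Nullary using (yes; no; does; ¬_)
open import Relation.Nullary.Decidable using (_×-dec_; dec-true)
open import Relation.Unary using (Pred; Decidable)
open import Function using (_∘_; id)
open import Relation.Binary.PropositionalEquality using (_≢_; refl; sym; trans; cong; subst; subst₂)
open import Data.Integer as ℤ using (+_; -[1+_])
import Data.Integer.Properties as ℤ
import Data.Integer.DivMod as ℤ
open import Data.Rational as ℚ using (mkℚ)
import Data.Rational.Properties as ℚ

x∈p─q⇒x∉q : ∀ {n} {p q : Subset n} {x} → x ∈ p ─ q → x ∉ q
x∈p─q⇒x∉q {p = inside ∷ p} {outside ∷ q} here ()
x∈p─q⇒x∉q {p = _ ∷ p} {_ ∷ q} (there x∈) (there x∈q) = x∈p─q⇒x∉q x∈ x∈q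

∣p∪q∣≤∣p∣+∣q∣ : ∀ {n} (p q : Subset n) → ∣ p ∪ q ∣ ≤ ∣ p ∣ + ∣ q ∣
∣p∪q∣≤∣p∣+∣q∣ []            []            = z≤n
∣p∪q∣≤∣p∣+∣q∣ (outside ∷ p) (outside ∷ q) = ∣p∪q∣≤∣p∣+∣q∣ p q
∣p∪q∣≤∣p∣+∣q∣ (inside  ∷ p) (outside ∷ q) = s≤s (∣p∪q∣≤∣p∣+∣q∣ p q)
∣p∪q∣≤∣p∣+∣q∣ (outside ∷ p) (inside  ∷ q) =
  subst (suc ∣ p ∪ q ∣ ≤_) (sym (ℕ.+-suc ∣ p ∣ ∣ q ∣)) (s≤s (∣p∪q∣≤∣p∣+∣q∣ p q))
∣p∪q∣≤∣p∣+∣q∣ (inside  ∷ p) (inside  ∷ q) =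
  s≤s (ℕ.≤-trans (∣p∪q∣≤∣p∣+∣q∣ p q) (ℕ.+-monoʳ-≤ ∣ p ∣ (ℕ.n≤1+n ∣ q ∣)))

p⊆p─q∪q : ∀ {n} (p q : Subset n) → p ⊆ (p ─ q) ∪ q
p⊆p─q∪q p q {x} x∈p with x ∈? q
... | yes x∈q = x∈p∪q⁺ (inj₂ x∈q)
... | no  x∉q = x∈p∪q⁺ (inj₁ (x∈p∧x∉q⇒x∈p─q x∈p x∉q))

∣p∣≤∣p─q∣+∣q∣ : ∀ {n} (p q : Subset n) → ∣ p ∣ ≤ ∣ p ─ q ∣ + ∣ q ∣
∣p∣≤∣p─q∣+∣q∣ p q = ℕ.≤-trans (p⊆q⇒∣p∣≤∣q∣ (p⊆p─q∪q p q)) (∣p∪q∣≤∣p∣+∣q∣ (p ─ q) q)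

⋃[_]_ : ∀ {n m} → Subset n → (Fin n → Subset m) → Subset m
⋃[ []          ] f = ⊥
⋃[ outside ∷ p ] f = ⋃[ p ] (f ∘ suc)
⋃[ inside  ∷ p ] f = f zero ∪ ⋃[ p ] (f ∘ suc)

∈-⋃[] : ∀ {n m} (p : Subset n) (f : Fin n → Subset m) {i x} → i ∈ p → x ∈ f i → x ∈ ⋃[ p ] f
∈-⋃[] (outside ∷ p) f (there i∈p) x∈fi = ∈-⋃[] p (f ∘ suc) i∈p x∈fi
∈-⋃[] (inside  ∷ p) f here        x∈fi = x∈p∪q⁺ (inj₁ x∈fi)
∈-⋃[] (inside  ∷ p) f (there i∈p) x∈fi = x∈p∪q⁺ (inj₂ (∈-⋃[] p (f ∘ suc) i∈p x∈fi))

∣⋃[]∣≤ : ∀ {n m} (p : Subset n) (f : Fin n → Subset m) {B} →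
         (∀ {i} → i ∈ p → ∣ f i ∣ ≤ B) → ∣ ⋃[ p ] f ∣ ≤ ∣ p ∣ * B
∣⋃[]∣≤ {m = m} []  f bound = ℕ.≤-reflexive (∣⊥∣≡0 m)
∣⋃[]∣≤ (outside ∷ p) f bound = ∣⋃[]∣≤ p (f ∘ suc) (bound ∘ there)
∣⋃[]∣≤ (inside  ∷ p) f bound = ℕ.≤-trans (∣p∪q∣≤∣p∣+∣q∣ (f zero) _)
  (ℕ.+-mono-≤ (bound here) (∣⋃[]∣≤ p (f ∘ suc) (bound ∘ there)))

subset-of-size : ∀ {n} (p : Subset n) {c} → c ≤ ∣ p ∣ → ∃[ q ] (q ⊆ p × ∣ q ∣ ≡ c)
subset-of-size {n} p {zero} _ = ⊥ , ⊥⊆ , ∣⊥∣≡0 n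
subset-of-size (outside ∷ p) {suc c} c<∣p∣ with subset-of-size p c<∣p∣
... | q , q⊆p , ∣q∣≡c = outside ∷ q , (λ { (there x∈q) → there (q⊆p x∈q) }) , ∣q∣≡c
subset-of-size (inside ∷ p) {suc c} (s≤s c≤∣p∣) with subset-of-size p c≤∣p∣
... | q , q⊆p , ∣q∣≡c =
  inside ∷ q , (λ { here → here ; (there x∈q) → there (q⊆p x∈q) }) , cong suc ∣q∣≡c

select : ∀ {n p} {P : Pred (Fin n) p} → Decidable P → Subset n
select P? = Vec.tabulate (does ∘ P?)

length-filter-tabulate : ∀ {a p} {A : Set a} {P : Pred A p} (P? : Decidable P) {n} (h : Fin n → A) →
  length (filter P? (List.tabulate h)) ≡ ∣ Vec.tabulate (does ∘ P? ∘ h) ∣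
length-filter-tabulate P? {zero} h = refl
length-filter-tabulate P? {suc n} h with does (P? (h zero))
... | true  = cong suc (length-filter-tabulate P? (h ∘ suc))
... | false = length-filter-tabulate P? (h ∘ suc)

module _ {n p} {P : Pred (Fin n) p} (P? : Decidable P) where

  ∈-select⁻ : ∀ {i} → i ∈ select P? → P i
  ∈-select⁻ {i} i∈ with P? i | trans (sym (Vec.lookup∘tabulate (does ∘ P?) i)) (Vec.[]=⇒lookup i∈)
  ... | yes Pi | _ = Pi
  ... | no _   | ()

  ∈-select⁺ : ∀ {i} → P i → i ∈ select P?
  ∈-select⁺ {i} Pi = Vec.lookup⇒[]= i _ (trans (Vec.lookup∘tabulate (does ∘ P?) i) (dec-true (P? i) Pi))

  length-filter-allFin : length (filter P? (allFin n)) ≡ ∣ select P? ∣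
  length-filter-allFin = length-filter-tabulate P? id

∈⇒≤foldr-⊔ : ∀ {x xs} → x List.∈ xs → x ≤ foldr _⊔_ 0 xs
∈⇒≤foldr-⊔ {xs = y List.∷ _} (here refl)  = ℕ.m≤m⊔n y _
∈⇒≤foldr-⊔ {xs = y List.∷ _} (there x∈xs) = ℕ.≤-trans (∈⇒≤foldr-⊔ x∈xs) (ℕ.m≤n⊔m y _)

foldr-⊔≤ : ∀ {d xs} → All (_≤ d) xs → foldr _⊔_ 0 xs ≤ d
foldr-⊔≤ = List.foldr-preservesᵇ ℕ.⊔-lub z≤n

⌈⌉ℕ≤1+quotient : ∀ a b .(c : Coprimality.Coprime (suc a) (suc b)) →
                ⌈ mkℚ (+ suc a) b c ⌉ℕ ≤ suc (suc a ℕ./ suc b)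
⌈⌉ℕ≤1+quotient a b c = subst (_≤ suc (suc a ℕ./ suc b)) (sym ⌈r⌉ℕ≡) ∣-[1+a]/ℕ1+b∣≤
  where
  ⌈r⌉ℕ≡ : ⌈ mkℚ (+ suc a) b c ⌉ℕ ≡ ℤ.∣ -[1+ a ] ℤ./ℕ suc b ∣
  ⌈r⌉ℕ≡ = trans (ℤ.∣-i∣≡∣i∣ (-[1+ a ] ℤ./ + suc b)) (cong ℤ.∣_∣ (ℤ.div-pos-is-/ℕ -[1+ a ] (suc b)))
  ∣-[1+a]/ℕ1+b∣≤ : ℤ.∣ -[1+ a ] ℤ./ℕ suc b ∣ ≤ suc (suc a ℕ./ suc b)
  ∣-[1+a]/ℕ1+b∣≤ with suc a ℕ.% suc b
  ... | zero  = ℕ.≤-trans (ℕ.≤-reflexive (ℤ.∣-i∣≡∣i∣ (+ (suc a ℕ./ suc b)))) (ℕ.n≤1+n _)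
  ... | suc _ = ℕ.≤-refl

ℕtoℚ≡mkℚ : ∀ d → ℕtoℚ d ≡ mkℚ (+ d) 0 (Coprimality.sym (Coprimality.1-coprimeTo d))
ℕtoℚ≡mkℚ d = ℚ.normalize-coprime (Coprimality.sym (Coprimality.1-coprimeTo d))

≤pred⌈⌉ℕ⇒≤ : ∀ {d} r → Positive r → d ≤ ℕ.pred ⌈ r ⌉ℕ → ℚ._≤_ (ℕtoℚ d) r
≤pred⌈⌉ℕ⇒≤ {d} (mkℚ (+ suc a) b c) _ d≤ rewrite ℕtoℚ≡mkℚ d =
  ℚ.*≤* (subst₂ ℤ._≤_ (ℤ.pos-* d (suc b)) (sym (ℤ.*-identityʳ (+ suc a))) (ℤ.+≤+ d*D≤N))
  where
  d*D≤N : d ℕ.* suc b ≤ suc a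
  d*D≤N = ℕ.≤-trans (ℕ.*-monoˡ-≤ (suc b) (ℕ.≤-trans d≤ (ℕ.pred-mono-≤ (⌈⌉ℕ≤1+quotient a b c))))
                    (ℕ.m/n*n≤m (suc a) (suc b))

module Hypergraph {n m : ℕ} (edge : Fin m → Subset n) where

  Γ : Subset m → Fin n → Subset m
  Γ G v = select (λ i → (i ∈? G) ×-dec (v ∈? edge i))

  deg≡∣Γ∣ : ∀ G v → deg edge G v ≡ ∣ Γ G v ∣
  deg≡∣Γ∣ G v = length-filter-allFin (λ i → (i ∈? G) ×-dec (v ∈? edge i))

  ∈Γ⁻ : ∀ G v {i} → i ∈ Γ G v → i ∈ G × v ∈ edge i
  ∈Γ⁻ G v = ∈-select⁻ (λ i → (i ∈? G) ×-dec (v ∈? edge i))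

  ∈Γ⁺ : ∀ {G v i} → i ∈ G → v ∈ edge i → i ∈ Γ G v
  ∈Γ⁺ {G} {v} i∈G v∈i = ∈-select⁺ (λ i → (i ∈? G) ×-dec (v ∈? edge i)) (i∈G , v∈i)

  deg≤Δ₁ : ∀ G v → deg edge G v ≤ Δ₁ edge G
  deg≤Δ₁ G v = ∈⇒≤foldr-⊔ (List.∈-map⁺ (deg edge G) (List.∈-allFin v))

  Δ₁-lub : ∀ G {d} → (∀ v → deg edge G v ≤ d) → Δ₁ edge G ≤ d
  Δ₁-lub G deg≤d = foldr-⊔≤ (All.map⁺ (All.tabulate⁺ deg≤d))

  ∣Γ∣≤Δ₁ : ∀ G v → ∣ Γ G v ∣ ≤ Δ₁ edge G
  ∣Γ∣≤Δ₁ G v = subst (_≤ Δ₁ edge G) (deg≡∣Γ∣ G v) (deg≤Δ₁ G v)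

  edgesMeetingEdge : Subset m → Fin m → Subset m
  edgesMeetingEdge G j = ⋃[ edge j ] Γ G

  edgesMeetingStar : ∀ G {c} → Star edge G c → Subset m
  edgesMeetingStar G s = ⋃[ Star.W s ] edgesMeetingEdge G

  edgesMeeting : ∀ G {c t} → (Fin t → Star edge G c) → Subset m
  edgesMeeting G S = ⋃[ ⊤ ] (edgesMeetingStar G ∘ S)

  ∈edgesMeeting : ∀ {G c t} (S : Fin t → Star edge G c) {a i w} →
                  i ∈ G → w ∈ edge i → InV edge (S a) w → i ∈ edgesMeeting G S
  ∈edgesMeeting {G} S {a} i∈G w∈i (j , j∈W , w∈j) =
    ∈-⋃[] ⊤ (edgesMeetingStar G ∘ S) ∈⊤
      (∈-⋃[] (Star.W (S a)) (edgesMeetingEdge G) j∈W (∈-⋃[] (edge j) (Γ G) w∈j (∈Γ⁺ i∈G w∈i)))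

  module _ {k} (∣edge∣≤k : ∀ i → ∣ edge i ∣ ≤ k) (G : Subset m) where

    ∣edgesMeetingEdge∣≤ : ∀ j → ∣ edgesMeetingEdge G j ∣ ≤ k * Δ₁ edge G
    ∣edgesMeetingEdge∣≤ j = ℕ.≤-trans (∣⋃[]∣≤ (edge j) (Γ G) λ {w} _ → ∣Γ∣≤Δ₁ G w)
                                      (ℕ.*-monoˡ-≤ (Δ₁ edge G) (∣edge∣≤k j))

    ∣edgesMeetingStar∣≤ : ∀ {c} (s : Star edge G c) → ∣ edgesMeetingStar G s ∣ ≤ c * (k * Δ₁ edge G)
    ∣edgesMeetingStar∣≤ s = subst (λ c → ∣ edgesMeetingStar G s ∣ ≤ c * (k * Δ₁ edge G)) (Star.size s)
      (∣⋃[]∣≤ (Star.W s) (edgesMeetingEdge G) λ {j} _ → ∣edgesMeetingEdge∣≤ j)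

    ∣edgesMeeting∣≤ : ∀ {c t} (S : Fin t → Star edge G c) →
                      ∣ edgesMeeting G S ∣ ≤ t * (c * (k * Δ₁ edge G))
    ∣edgesMeeting∣≤ {c} {t} S = subst (λ t → ∣ edgesMeeting G S ∣ ≤ t * (c * (k * Δ₁ edge G))) (∣⊤∣≡n t)
      (∣⋃[]∣≤ ⊤ (edgesMeetingStar G ∘ S) λ {a} _ → ∣edgesMeetingStar∣≤ (S a))

  edgesAvoiding : ∀ G {c t} → (Fin t → Star edge G c) → Subset m
  edgesAvoiding G S = G ─ edgesMeeting G S

  starOfDegree : ∀ {F G c} → F ⊆ G → ∀ v → c ≤ deg edge F v → Σ (Star edge G c) λ s → Star.W s ⊆ F
  starOfDegree {F} {c = c} F⊆G v c≤deg with subset-of-size (Γ F v) (subst (c ≤_) (deg≡∣Γ∣ F v) c≤deg)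
  ... | W , W⊆Γ , ∣W∣≡c = s , proj₁ ∘ ∈Γ⁻ F v ∘ W⊆Γ
    where
    s : Star edge _ c
    s = record { centre = v ; W = W ; W⊆G = F⊆G ∘ proj₁ ∘ ∈Γ⁻ F v ∘ W⊆Γ
               ; W⊆Γv = λ i → proj₂ ∘ ∈Γ⁻ F v ∘ W⊆Γ ; size = ∣W∣≡c }

  extendDisjointStars : ∀ {G c t} (D : DisjointStars edge G c t) (s : Star edge G c) →
           (∀ a w → InV edge s w → ¬ InV edge (proj₁ D a) w) → DisjointStars edge G c (suc t)
  extendDisjointStars {G} {c} {t} (S , disjoint) s s#S = S′ , disjoint′
    where
    S′ : Fin (suc t) → Star edge G c
    S′ zero    = s
    S′ (suc a) = S a
    disjoint′ : ∀ a b → a ≢ b → ∀ w → ¬ (InV edge (S′ a) w × InV edge (S′ b) w)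
    disjoint′ zero    zero    a≢b _ _          = a≢b refl
    disjoint′ zero    (suc b) _   w (w∈s , w∈Sb) = s#S b w w∈s w∈Sb
    disjoint′ (suc a) zero    _   w (w∈Sa , w∈s) = s#S a w w∈s w∈Sa
    disjoint′ (suc a) (suc b) a≢b = disjoint a b (a≢b ∘ cong suc)

  deg-edgesAvoiding<c : ∀ {G c t} (D : DisjointStars edge G c t) → ¬ DisjointStars edge G c (suc t) →
                        ∀ v → deg edge (edgesAvoiding G (proj₁ D)) v < c
  deg-edgesAvoiding<c {G} {c} D@(S , _) maximal v = ℕ.≰⇒> λ c≤deg →
    let s , W⊆F = starOfDegree (p─q⊆p G (edgesMeeting G S)) v c≤deg
    in  maximal (extendDisjointStars D s λ { a w (i , i∈W , w∈i) w∈Sa →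
          x∈p─q⇒x∉q (W⊆F i∈W) (∈edgesMeeting S (p─q⊆p G _ (W⊆F i∈W)) w∈i w∈Sa) })

  Δ₁-edgesAvoiding≤pred : ∀ {G c t} (D : DisjointStars edge G c t) → ¬ DisjointStars edge G c (suc t) →
                          Δ₁ edge (edgesAvoiding G (proj₁ D)) ≤ ℕ.pred c
  Δ₁-edgesAvoiding≤pred D maximal = Δ₁-lub _ (ℕ.<⇒≤pred ∘ deg-edgesAvoiding<c D maximal)

reorder : ∀ t c k d → t * (c * (k * d)) ≡ 1 * k * c * t * d
reorder = solve-∀

lemma3p3 : (k : ℕ) → 1 ≤ k → (n m : ℕ) (edge : Fin m → Subset n) →
    Injective _≡_ _≡_ edge → (∀ i → ∣ edge i ∣ ≤ k) →
    (r : ℚ) → Positive r →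
    (U : Subset n) (Hp : Subset m) → IsInduced edge U Hp →
    (Xr M : ℕ) → IsXr edge U r Xr → IsM edge Hp ⌈ r ⌉ℕ M →
    (Xr ≤ e edge Hp)
    × (e edge Hp ≤ Xr + 𝟙> (Δ₁ edge Hp) r * k * ⌈ r ⌉ℕ * M * Δ₁ edge Hp)
lemma3p3 k _ n m edge _ ∣edge∣≤k r r>0 U Hp (Hp⊆H[U] , H[U]⊆Hp) Xr M
         ((G , G⊆H[U] , _ , ∣G∣≡Xr) , Xr-max) (D@(S , _) , M-max) = Xr≤e , e≤Xr+
  where
  open Hypergraph edge
  Δ = Δ₁ edge Hp
  c = ⌈ r ⌉ℕ

  Xr≤e : Xr ≤ e edge Hp
  Xr≤e = subst (_≤ e edge Hp) ∣G∣≡Xr (p⊆q⇒∣p∣≤∣q∣ λ {i} i∈G → H[U]⊆Hp i (G⊆H[U] i i∈G))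

  Δ₁-avoiding≤r : ℚ._≤_ (ℕtoℚ (Δ₁ edge (edgesAvoiding Hp S))) r
  Δ₁-avoiding≤r = ≤pred⌈⌉ℕ⇒≤ r r>0 (Δ₁-edgesAvoiding≤pred D (ℕ.n≮n M ∘ M-max (suc M)))

  e≤Xr+MckΔ : e edge Hp ≤ Xr + M * (c * (k * Δ))
  e≤Xr+MckΔ = ℕ.≤-trans (∣p∣≤∣p─q∣+∣q∣ Hp (edgesMeeting Hp S))
    (ℕ.+-mono-≤ (Xr-max (edgesAvoiding Hp S) (λ i → Hp⊆H[U] i ∘ p─q⊆p Hp _) Δ₁-avoiding≤r)
                (∣edgesMeeting∣≤ ∣edge∣≤k Hp S))

  e≤Xr+ : e edge Hp ≤ Xr + 𝟙> Δ r * k * c * M * Δ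
  e≤Xr+ with r ℚ.<? ℕtoℚ Δ
  ... | yes _   = subst (λ b → e edge Hp ≤ Xr + b) (reorder M c k Δ) e≤Xr+MckΔ
  ... | no Δ≯r = ℕ.≤-trans (Xr-max Hp Hp⊆H[U] (ℚ.≮⇒≥ Δ≯r)) (ℕ.m≤m+n Xr 0)
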